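{- Let $V\subseteq\{0,1\}^n$ be a finite set and $\preceq$ a term order on $\mathbb{R}[x_1,\dots,x_n]$. For $i\in[n]$ let $T_i:\{0,1\}^n\to\{0,1\}^n$ be the map $(v_1,\dots,v_n)\mapsto(v_1,\dots,v_{i-1},1-v_i,v_{i+1},\dots,v_n)$. Then $\mathcal{S}_\preceq(V)=\mathcal{S}_\preceq(T_i(V))$ for every $i=1,\dots,n$.
   Context: For finite $V\subseteq\{0,1\}^n$, $\mathcal{S}_\preceq(V)=\{\tau\subseteq[n]:\prod_{j\in\tau}x_j\notin\mathrm{in}_\preceq(I(V))\}$, where $I(V)$ is the ideal of polynomials vanishing on $V$ and $\mathrm{in}_\preceq$ denotes the initial ideal.
   Formalization: Polynomials are taken with rational rather than real coefficients, which affects $I(V)$, its initial ideal and $\mathcal{S}_\preceq(V)$. -}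

module Defs where

open import Data.Nat as ℕ using (ℕ; zero; suc)
open import Data.Bool using (Bool; true; false; not; if_then_else_)
open import Data.Fin using (Fin)
open import Data.Vec using (Vec; lookup; zipWith; replicate; map; updateAt)
open import Data.Vec.Properties using (≡-dec)
open import Data.List as List using (List; []; _∷_)
open import Data.List.Membership.Propositional using (_∈_)
open import Data.Product using (_×_; _,_; ∃-syntax)
open import Data.Sum using (_⊎_)
open import Relation.Nullary using (¬_; yes; no)
open import Relation.Binary.PropositionalEquality using (_≡_)
open import Data.Rational as ℚ using (ℚ; 0ℚ; 1ℚ)

Exp : ℕ → Set
Exp n = Vec ℕ n

_⊕_ : ∀ {n} → Exp n → Exp n → Exp n
_⊕_ = zipWith ℕ._+_

0ₑ : ∀ {n} → Exp n
0ₑ = replicate _ 0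

_∣ₘ_ : ∀ {n} → Exp n → Exp n → Set
a ∣ₘ b = ∀ j → lookup a j ℕ.≤ lookup b j

record TermOrder (n : ℕ) : Set₁ where
  field
    _≼_       : Exp n → Exp n → Set
    refl≼     : ∀ a → a ≼ a
    antisym≼  : ∀ {a b} → a ≼ b → b ≼ a → a ≡ b
    trans≼    : ∀ {a b c} → a ≼ b → b ≼ c → a ≼ c
    total≼    : ∀ a b → a ≼ b ⊎ b ≼ a
    mult≼     : ∀ {a b} c → a ≼ b → (a ⊕ c) ≼ (b ⊕ c)
    one-min   : ∀ a → 0ₑ ≼ a

-- Polynomials with rational coefficients: finite lists of terms c·x^a
-- (like terms may repeat; the polynomial is their sum).
Poly : ℕ → Set
Poly n = List (ℚ × Exp n)

coeff : ∀ {n} → Poly n → Exp n → ℚ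
coeff [] a = 0ℚ
coeff ((c , b) ∷ f) a with ≡-dec ℕ._≟_ b a
... | yes _ = c ℚ.+ coeff f a
... | no  _ = coeff f a

_^ℚ_ : ℚ → ℕ → ℚ
q ^ℚ zero = 1ℚ
q ^ℚ suc k = q ℚ.* (q ^ℚ k)

bit : Bool → ℚ
bit true  = 1ℚ
bit false = 0ℚ

Point : ℕ → Set
Point n = Vec Bool n

evalMono : ∀ {n} → Exp n → Point n → ℚ
evalMono a v = Data.Vec.foldr _ ℚ._*_ 1ℚ (zipWith (λ e b → bit b ^ℚ e) a v)

eval : ∀ {n} → Poly n → Point n → ℚ
eval [] v = 0ℚ
eval ((c , a) ∷ f) v = c ℚ.* evalMono a v ℚ.+ eval f v

_∈I[_] : ∀ {n} → Poly n → List (Point n) → Set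
f ∈I[ V ] = ∀ v → v ∈ V → eval f v ≡ 0ℚ

LeadingMono : ∀ {n} → TermOrder n → Poly n → Exp n → Set
LeadingMono ord f m =
  ¬ (coeff f m ≡ 0ℚ) × (∀ a → ¬ (coeff f a ≡ 0ℚ) → a ≼ m)
  where open TermOrder ord

-- x^m ∈ in_≼(I(V)): the initial ideal is the monomial ideal generated by
-- the leading monomials of nonzero elements of I(V); a monomial lies in it
-- iff it is divisible by one of these generators.
_∈in[_,_] : ∀ {n} → Exp n → TermOrder n → List (Point n) → Set
m ∈in[ ord , V ] =
  ∃[ f ] ∃[ l ] (f ∈I[ V ] × LeadingMono ord f l × l ∣ₘ m)

-- squarefree monomial x^τ = ∏_{j∈τ} x_j, τ ⊆ [n] as a characteristic vector
sqfree : ∀ {n} → Vec Bool n → Exp n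
sqfree = map (λ b → if b then 1 else 0)

_∈S[_,_] : ∀ {n} → Vec Bool n → TermOrder n → List (Point n) → Set
τ ∈S[ ord , V ] = ¬ (sqfree τ ∈in[ ord , V ])

T : ∀ {n} → Fin n → Point n → Point n
T i v = updateAt v i not

TV : ∀ {n} → Fin n → List (Point n) → List (Point n)
TV i V = List.map (T i) V

{-# OPTIONS --safe #-}
-- Substituting x_i ↦ 1 − x_i maps polynomials vanishing on V to polynomials vanishing on T_i(V).
-- Reduced by x_i^k = x_i (k ≥ 1), valid on {0,1}^n, it sends x^b to x^b if b_i = 0 and to
-- x^(b[i≔0]) − x^(b[i≔1]) otherwise; every monomial produced divides x^b and so is ≼ x^b.
-- Hence the coefficients at monomials ≽ the leading monomial x^l are only rescaled, that of x^l
-- by ±1 when l_i ≤ 1, which holds when x^l divides a squarefree monomial.  This carries the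
-- squarefree monomials of in(I(V)) into in(I(T_i V)); the converse holds as T_i is an involution.
module Submission where

open import Defs
open import Data.Nat as ℕ using (ℕ; zero; suc; z≤n; s≤s; _≤_)
import Data.Nat.Properties as ℕₚ
open import Data.Fin using (Fin; zero; suc)
open import Data.Bool using (Bool; true; false; not; if_then_else_)
open import Data.Bool.Properties using (not-involutive)
open import Data.Vec using (Vec; []; _∷_; lookup; updateAt; zipWith; _[_]≔_)
open import Data.Vec.Properties
  using (≡-dec; lookup-map; lookup∘update; lookup∘updateAt; []≔-idempotent; []≔-lookup
        ; updateAt-updateAt; updateAt-id-local; zipWith-identityˡ)
open import Data.List as List using (List; []; _∷_; _++_; length; concatMap)
open import Data.List.Membership.Propositional using (_∈_)
open import Data.List.Membership.Propositional.Properties using (∈-map⁺; ∈-map⁻)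
open import Data.List.Relation.Binary.Subset.Propositional using (_⊆_)
open import Data.List.Relation.Unary.All as All using (All; []; _∷_)
open import Data.List.Relation.Unary.Any using (here; there)
open import Data.Product using (_×_; _,_; proj₂; map₁)
open import Data.Sum as Sum using (_⊎_; inj₁; inj₂)
open import Function using (_∘_)
open import Relation.Nullary using (yes; no; contradiction)
open import Relation.Binary.PropositionalEquality
open ≡-Reasoning
open import Data.Rational as ℚ using (ℚ; 0ℚ; 1ℚ; _+_; _-_; _*_; -_; 1/_)
import Data.Rational.Properties as ℚₚ
open import Data.Rational.Solver using (module +-*-Solver)
open +-*-Solver using (solve; _:=_; _:+_; _:*_; _:-_; :-_; con)

p≡0∨q≡0⇒p*q≡0 : ∀ {p q} → p ≡ 0ℚ ⊎ q ≡ 0ℚ → p * q ≡ 0ℚ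
p≡0∨q≡0⇒p*q≡0 {q = q} (inj₁ refl) = ℚₚ.*-zeroˡ q
p≡0∨q≡0⇒p*q≡0 {p = p} (inj₂ refl) = ℚₚ.*-zeroʳ p

p*q≡0∧q≢0⇒p≡0 : ∀ p q → p * q ≡ 0ℚ → q ≢ 0ℚ → p ≡ 0ℚ
p*q≡0∧q≢0⇒p≡0 p q pq≡0 q≢0 = begin
  p               ≡⟨ ℚₚ.*-identityʳ p ⟨
  p * 1ℚ          ≡⟨ cong (p *_) (ℚₚ.*-inverseʳ q) ⟨
  p * (q * 1/ q)  ≡⟨ ℚₚ.*-assoc p q (1/ q) ⟨
  p * q * 1/ q    ≡⟨ cong (_* 1/ q) pq≡0 ⟩
  0ℚ * 1/ q       ≡⟨ ℚₚ.*-zeroˡ (1/ q) ⟩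
  0ℚ              ∎
  where
  instance
    q≠0 : ℚ.NonZero q
    q≠0 = ℚ.≢-nonZero q≢0

∣ₘ-refl : ∀ {n} (a : Exp n) → a ∣ₘ a
∣ₘ-refl a j = ℕₚ.≤-refl

[]≔-∣ₘ : ∀ {n} (b : Exp n) j {y} → y ≤ lookup b j → (b [ j ]≔ y) ∣ₘ b
[]≔-∣ₘ (_ ∷ _) zero    y≤bⱼ zero    = y≤bⱼ
[]≔-∣ₘ (_ ∷ _) zero    _    (suc _) = ℕₚ.≤-refl
[]≔-∣ₘ (_ ∷ _) (suc _) _    zero    = ℕₚ.≤-refl
[]≔-∣ₘ (_ ∷ b) (suc j) y≤bⱼ (suc k) = []≔-∣ₘ b j y≤bⱼ k

∸-⊕-cancel : ∀ {n} (a b : Exp n) → a ∣ₘ b → zipWith ℕ._∸_ b a ⊕ a ≡ b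
∸-⊕-cancel []      []      _   = refl
∸-⊕-cancel (_ ∷ a) (_ ∷ b) a∣b =
  cong₂ _∷_ (ℕₚ.m∸n+n≡m (a∣b zero)) (∸-⊕-cancel a b (a∣b ∘ suc))

∣ₘ⇒≼ : ∀ {n} (ord : TermOrder n) {a b : Exp n} → a ∣ₘ b → TermOrder._≼_ ord a b
∣ₘ⇒≼ ord {a} {b} a∣b =
  subst₂ _≼_ (zipWith-identityˡ ℕₚ.+-identityˡ a) (∸-⊕-cancel a b a∣b)
    (mult≼ a (one-min (zipWith ℕ._∸_ b a)))
  where open TermOrder ord

bit-^-suc : ∀ x k → bit x ^ℚ suc k ≡ bit x
bit-^-suc false k = ℚₚ.*-zeroˡ (0ℚ ^ℚ k)
bit-^-suc true  k = trans (ℚₚ.*-identityˡ _) (1^k≡1 k)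
  where
  1^k≡1 : ∀ k → 1ℚ ^ℚ k ≡ 1ℚ
  1^k≡1 zero    = refl
  1^k≡1 (suc k) = trans (ℚₚ.*-identityˡ _) (1^k≡1 k)

bit-not : ∀ x → bit (not x) ≡ 1ℚ - bit x
bit-not false = refl
bit-not true  = refl

evalMono-split : ∀ {n} (i : Fin n) (b : Exp n) (v : Point n) →
  evalMono b v ≡ bit (lookup v i) ^ℚ lookup b i * evalMono (b [ i ]≔ 0) v
evalMono-split zero    (e ∷ b) (x ∷ v) = cong (bit x ^ℚ e *_) (sym (ℚₚ.*-identityˡ _))
evalMono-split (suc i) (e ∷ b) (x ∷ v) = begin
  bit x ^ℚ e * evalMono b v                        ≡⟨ cong (bit x ^ℚ e *_) (evalMono-split i b v) ⟩
  bit x ^ℚ e * (bit (lookup v i) ^ℚ lookup b i * E)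
    ≡⟨ solve 3 (λ p q r → p :* (q :* r) := q :* (p :* r)) refl
         (bit x ^ℚ e) (bit (lookup v i) ^ℚ lookup b i) E ⟩
  bit (lookup v i) ^ℚ lookup b i * (bit x ^ℚ e * E) ∎
  where
  E : ℚ
  E = evalMono (b [ i ]≔ 0) v

evalMono-[]≔0-updateAt : ∀ {n} (i : Fin n) (b : Exp n) (v : Point n) h →
  evalMono (b [ i ]≔ 0) (updateAt v i h) ≡ evalMono (b [ i ]≔ 0) v
evalMono-[]≔0-updateAt zero    (_ ∷ _) (_ ∷ _) _ = refl
evalMono-[]≔0-updateAt (suc i) (e ∷ b) (x ∷ v) h =
  cong (bit x ^ℚ e *_) (evalMono-[]≔0-updateAt i b v h)

evalMono-T : ∀ {n} (i : Fin n) (b : Exp n) (v : Point n) →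
  evalMono b (T i v) ≡ bit (not (lookup v i)) ^ℚ lookup b i * evalMono (b [ i ]≔ 0) v
evalMono-T i b v = begin
  evalMono b (T i v)
    ≡⟨ evalMono-split i b (T i v) ⟩
  bit (lookup (T i v) i) ^ℚ lookup b i * evalMono (b [ i ]≔ 0) (T i v)
    ≡⟨ cong₂ (λ x E → bit x ^ℚ lookup b i * E) (lookup∘updateAt i v) (evalMono-[]≔0-updateAt i b v not) ⟩
  bit (not (lookup v i)) ^ℚ lookup b i * evalMono (b [ i ]≔ 0) v ∎

linExt : ∀ {n} → (Exp n → ℚ) → Poly n → ℚ
linExt K []            = 0ℚ
linExt K ((c , b) ∷ f) = c * K b + linExt K f

scale : ∀ {n} → ℚ → Poly n → Poly n
scale c = List.map (map₁ (c *_))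

substMono : ∀ {n} → (Exp n → Poly n) → Poly n → Poly n
substMono φ = concatMap (λ (c , b) → scale c (φ b))

linExt-cong : ∀ {n} {K L : Exp n → ℚ} → K ≗ L → ∀ f → linExt K f ≡ linExt L f
linExt-cong K≗L []            = refl
linExt-cong K≗L ((c , b) ∷ f) = cong₂ (λ x y → c * x + y) (K≗L b) (linExt-cong K≗L f)

linExt-++ : ∀ {n} (K : Exp n → ℚ) f g → linExt K (f ++ g) ≡ linExt K f + linExt K g
linExt-++ K []            g = sym (ℚₚ.+-identityˡ _)
linExt-++ K ((c , b) ∷ f) g =
  trans (cong (c * K b +_) (linExt-++ K f g)) (sym (ℚₚ.+-assoc (c * K b) _ _))

linExt-scale : ∀ {n} (K : Exp n → ℚ) c f → linExt K (scale c f) ≡ c * linExt K f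
linExt-scale K c []            = sym (ℚₚ.*-zeroʳ c)
linExt-scale K c ((d , b) ∷ f) = begin
  c * d * K b + linExt K (scale c f)
    ≡⟨ cong (c * d * K b +_) (linExt-scale K c f) ⟩
  c * d * K b + c * linExt K f
    ≡⟨ solve 4 (λ c d k l → c :* d :* k :+ c :* l := c :* (d :* k :+ l)) refl c d (K b) (linExt K f) ⟩
  c * (d * K b + linExt K f) ∎

linExt-substMono : ∀ {n} (K : Exp n → ℚ) φ f →
  linExt K (substMono φ f) ≡ linExt (linExt K ∘ φ) f
linExt-substMono K φ []            = refl
linExt-substMono K φ ((c , b) ∷ f) = begin
  linExt K (scale c (φ b) ++ substMono φ f)
    ≡⟨ linExt-++ K (scale c (φ b)) _ ⟩
  linExt K (scale c (φ b)) + linExt K (substMono φ f)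
    ≡⟨ cong₂ _+_ (linExt-scale K c (φ b)) (linExt-substMono K φ f) ⟩
  c * linExt K (φ b) + linExt (linExt K ∘ φ) f ∎

δ : ∀ {n} → Exp n → Exp n → ℚ
δ b a with ≡-dec ℕ._≟_ b a
... | yes _ = 1ℚ
... | no  _ = 0ℚ

coeff≡linExt : ∀ {n} (f : Poly n) a → coeff f a ≡ linExt (λ b → δ b a) f
coeff≡linExt []            a = refl
coeff≡linExt ((c , b) ∷ f) a with ≡-dec ℕ._≟_ b a
... | yes _ = cong₂ _+_ (sym (ℚₚ.*-identityʳ c)) (coeff≡linExt f a)
... | no  _ = trans (sym (ℚₚ.+-identityˡ _)) (cong₂ _+_ (sym (ℚₚ.*-zeroʳ c)) (coeff≡linExt f a))

eval≡linExt : ∀ {n} (f : Poly n) v → eval f v ≡ linExt (λ b → evalMono b v) f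
eval≡linExt []            v = refl
eval≡linExt ((c , b) ∷ f) v = cong (c * evalMono b v +_) (eval≡linExt f v)

coeff-substMono : ∀ {n} (φ : Exp n → Poly n) f a →
  coeff (substMono φ f) a ≡ linExt (λ b → coeff (φ b) a) f
coeff-substMono φ f a = begin
  coeff (substMono φ f) a                       ≡⟨ coeff≡linExt (substMono φ f) a ⟩
  linExt (λ b → δ b a) (substMono φ f)          ≡⟨ linExt-substMono (λ b → δ b a) φ f ⟩
  linExt (λ b → linExt (λ e → δ e a) (φ b)) f  ≡⟨ linExt-cong (λ b → coeff≡linExt (φ b) a) f ⟨
  linExt (λ b → coeff (φ b) a) f                ∎

eval-substMono : ∀ {n} (φ : Exp n → Poly n) f v →
  eval (substMono φ f) v ≡ linExt (λ b → eval (φ b) v) f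
eval-substMono φ f v = begin
  eval (substMono φ f) v                              ≡⟨ eval≡linExt (substMono φ f) v ⟩
  linExt (λ b → evalMono b v) (substMono φ f)         ≡⟨ linExt-substMono (λ b → evalMono b v) φ f ⟩
  linExt (λ b → linExt (λ e → evalMono e v) (φ b)) f  ≡⟨ linExt-cong (λ b → eval≡linExt (φ b) v) f ⟨
  linExt (λ b → eval (φ b) v) f                       ∎

coeff-∷-≡ : ∀ {n} c (b : Exp n) f → coeff ((c , b) ∷ f) b ≡ c + coeff f b
coeff-∷-≡ c b f with ≡-dec ℕ._≟_ b b
... | yes _   = refl
... | no  b≢b = contradiction refl b≢b

coeff-∷-≢ : ∀ {n} c {b a : Exp n} f → b ≢ a → coeff ((c , b) ∷ f) a ≡ coeff f a
coeff-∷-≢ c {b} {a} f b≢a with ≡-dec ℕ._≟_ b a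
... | yes b≡a = contradiction b≡a b≢a
... | no  _   = refl

coeff≢0⇒∈ : ∀ {n} (f : Poly n) {a} → coeff f a ≢ 0ℚ → a ∈ List.map proj₂ f
coeff≢0⇒∈ []            {a} f≢0 = contradiction refl f≢0
coeff≢0⇒∈ ((c , b) ∷ f) {a} f≢0 with ≡-dec ℕ._≟_ b a
... | yes b≡a = here (sym b≡a)
... | no  _   = there (coeff≢0⇒∈ f f≢0)

removeExp : ∀ {n} → Exp n → Poly n → Poly n
removeExp a [] = []
removeExp a ((c , b) ∷ f) with ≡-dec ℕ._≟_ b a
... | yes _ = removeExp a f
... | no  _ = (c , b) ∷ removeExp a f

length-removeExp : ∀ {n} (a : Exp n) f → length (removeExp a f) ≤ length f
length-removeExp a []            = z≤n
length-removeExp a ((c , b) ∷ f) with ≡-dec ℕ._≟_ b a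
... | yes _ = ℕₚ.m≤n⇒m≤1+n (length-removeExp a f)
... | no  _ = s≤s (length-removeExp a f)

length-removeExp-head : ∀ {n} c (b : Exp n) f → length (removeExp b ((c , b) ∷ f)) ≤ length f
length-removeExp-head c b f with ≡-dec ℕ._≟_ b b
... | yes _   = length-removeExp b f
... | no  b≢b = contradiction refl b≢b

coeff-removeExp-self : ∀ {n} (a : Exp n) f → coeff (removeExp a f) a ≡ 0ℚ
coeff-removeExp-self a []            = refl
coeff-removeExp-self a ((c , b) ∷ f) with ≡-dec ℕ._≟_ b a
... | yes _   = coeff-removeExp-self a f
... | no  b≢a = trans (coeff-∷-≢ c (removeExp a f) b≢a) (coeff-removeExp-self a f)

coeff-removeExp-other : ∀ {n} {a e : Exp n} f → e ≢ a → coeff (removeExp a f) e ≡ coeff f e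
coeff-removeExp-other                 []            e≢a = refl
coeff-removeExp-other {a = a} {e = e} ((c , b) ∷ f) e≢a with ≡-dec ℕ._≟_ b a
... | yes refl = trans (coeff-removeExp-other f e≢a) (sym (coeff-∷-≢ c f (e≢a ∘ sym)))
... | no  _ with ≡-dec ℕ._≟_ b e
...   | yes _ = cong (c +_) (coeff-removeExp-other f e≢a)
...   | no  _ = coeff-removeExp-other f e≢a

linExt-removeExp : ∀ {n} (K : Exp n → ℚ) f a →
  linExt K f ≡ coeff f a * K a + linExt K (removeExp a f)
linExt-removeExp K []            a = sym (trans (cong (_+ 0ℚ) (ℚₚ.*-zeroˡ (K a))) (ℚₚ.+-identityˡ 0ℚ))
linExt-removeExp K ((c , b) ∷ f) a with ≡-dec ℕ._≟_ b a
... | yes refl = trans (cong (c * K b +_) (linExt-removeExp K f b))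
  (solve 4 (λ c x k r → c :* k :+ (x :* k :+ r) := (c :+ x) :* k :+ r) refl
     c (coeff f b) (K b) (linExt K (removeExp b f)))
... | no  _    = trans (cong (c * K b +_) (linExt-removeExp K f a))
  (solve 3 (λ t s r → t :+ (s :+ r) := s :+ (t :+ r)) refl
     (c * K b) (coeff f a * K a) (linExt K (removeExp a f)))

VanishesOnSupport : ∀ {n} → (Exp n → ℚ) → Poly n → Set
VanishesOnSupport K f = ∀ b → coeff f b ≡ 0ℚ ⊎ K b ≡ 0ℚ

removeExp-vanishesOnSupport : ∀ {n} (K : Exp n → ℚ) f a →
  (∀ b → b ≢ a → coeff f b ≡ 0ℚ ⊎ K b ≡ 0ℚ) → VanishesOnSupport K (removeExp a f)
removeExp-vanishesOnSupport K f a vanish b with ≡-dec ℕ._≟_ b a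
... | yes refl = inj₁ (coeff-removeExp-self b f)
... | no  b≢a  = Sum.map₁ (trans (coeff-removeExp-other f b≢a)) (vanish b b≢a)

-- Terms of f may repeat and cancel, so like terms are collected one exponent at a time.
linExt-vanishesOnSupport : ∀ {n} (K : Exp n → ℚ) f → VanishesOnSupport K f → linExt K f ≡ 0ℚ
linExt-vanishesOnSupport K f = go (length f) f ℕₚ.≤-refl
  where
  go : ∀ k f → length f ≤ k → VanishesOnSupport K f → linExt K f ≡ 0ℚ
  go _       []                   _             _      = refl
  go (suc k) f@((c , b) ∷ f′) (s≤s |f′|≤k) vanish = begin
    linExt K f
      ≡⟨ linExt-removeExp K f b ⟩
    coeff f b * K b + linExt K (removeExp b f)
      ≡⟨ cong₂ _+_ (p≡0∨q≡0⇒p*q≡0 (vanish b)) (go k (removeExp b f) |f∖b|≤k vanish∖b) ⟩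
    0ℚ + 0ℚ
      ≡⟨ ℚₚ.+-identityˡ 0ℚ ⟩
    0ℚ ∎
    where
    |f∖b|≤k : length (removeExp b f) ≤ k
    |f∖b|≤k = ℕₚ.≤-trans (length-removeExp-head c b f′) |f′|≤k
    vanish∖b : VanishesOnSupport K (removeExp b f)
    vanish∖b = removeExp-vanishesOnSupport K f b (λ e _ → vanish e)

linExt-concentrated : ∀ {n} (K : Exp n → ℚ) f a →
  (∀ b → b ≢ a → coeff f b ≡ 0ℚ ⊎ K b ≡ 0ℚ) → linExt K f ≡ coeff f a * K a
linExt-concentrated K f a vanish = begin
  linExt K f
    ≡⟨ linExt-removeExp K f a ⟩
  coeff f a * K a + linExt K (removeExp a f)
    ≡⟨ cong (coeff f a * K a +_) (linExt-vanishesOnSupport K (removeExp a f) vanish∖a) ⟩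
  coeff f a * K a + 0ℚ
    ≡⟨ ℚₚ.+-identityʳ _ ⟩
  coeff f a * K a ∎
  where
  vanish∖a : VanishesOnSupport K (removeExp a f)
  vanish∖a = removeExp-vanishesOnSupport K f a vanish

module Flip {n : ℕ} (i : Fin n) where

  flipMonoAt : Exp n → ℕ → Poly n
  flipMonoAt b zero    = (1ℚ , b) ∷ []
  flipMonoAt b (suc _) = (1ℚ , b [ i ]≔ 0) ∷ (- 1ℚ , b [ i ]≔ 1) ∷ []

  flipMono : Exp n → Poly n
  flipMono b = flipMonoAt b (lookup b i)

  flipPoly : Poly n → Poly n
  flipPoly = substMono flipMono

  eval-flipMonoAt : ∀ b v {k} → lookup b i ≡ k → eval (flipMonoAt b k) (T i v) ≡ evalMono b v
  eval-flipMonoAt b v {zero} bᵢ≡0 = begin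
    1ℚ * evalMono b (T i v) + 0ℚ          ≡⟨ trans (ℚₚ.+-identityʳ _) (ℚₚ.*-identityˡ _) ⟩
    evalMono b (T i v)                    ≡⟨ evalMono-T i b v ⟩
    bit (not x) ^ℚ lookup b i * E         ≡⟨ cong (λ k → bit (not x) ^ℚ k * E) bᵢ≡0 ⟩
    1ℚ * E                                ≡⟨ cong (λ k → bit x ^ℚ k * E) bᵢ≡0 ⟨
    bit x ^ℚ lookup b i * E               ≡⟨ evalMono-split i b v ⟨
    evalMono b v                          ∎
    where
    x : Bool
    x = lookup v i
    E : ℚ
    E = evalMono (b [ i ]≔ 0) v
  eval-flipMonoAt b v {suc k} bᵢ≡1+k = begin
    1ℚ * evalMono (b [ i ]≔ 0) (T i v) + (- 1ℚ * evalMono (b [ i ]≔ 1) (T i v) + 0ℚ)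
      ≡⟨ cong₂ (λ p q → 1ℚ * p + (- 1ℚ * q + 0ℚ)) (evalMono-[]≔0-updateAt i b v not) b[i≔1]∘T ⟩
    1ℚ * E + (- 1ℚ * (bit (not x) * 1ℚ * E) + 0ℚ)
      ≡⟨ cong (λ y → 1ℚ * E + (- 1ℚ * (y * 1ℚ * E) + 0ℚ)) (bit-not x) ⟩
    1ℚ * E + (- 1ℚ * ((1ℚ - bit x) * 1ℚ * E) + 0ℚ)
      ≡⟨ solve 2 (λ y e → con 1ℚ :* e :+ (:- con 1ℚ :* ((con 1ℚ :- y) :* con 1ℚ :* e) :+ con 0ℚ) := y :* e)
           refl (bit x) E ⟩
    bit x * E
      ≡⟨ cong (_* E) (bit-^-suc x k) ⟨
    bit x ^ℚ suc k * E
      ≡⟨ cong (λ k → bit x ^ℚ k * E) bᵢ≡1+k ⟨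
    bit x ^ℚ lookup b i * E
      ≡⟨ evalMono-split i b v ⟨
    evalMono b v ∎
    where
    x : Bool
    x = lookup v i
    E : ℚ
    E = evalMono (b [ i ]≔ 0) v
    b[i≔1]∘T : evalMono (b [ i ]≔ 1) (T i v) ≡ bit (not x) * 1ℚ * E
    b[i≔1]∘T = begin
      evalMono (b [ i ]≔ 1) (T i v)
        ≡⟨ evalMono-T i (b [ i ]≔ 1) v ⟩
      bit (not x) ^ℚ lookup (b [ i ]≔ 1) i * evalMono ((b [ i ]≔ 1) [ i ]≔ 0) v
        ≡⟨ cong₂ (λ k c → bit (not x) ^ℚ k * evalMono c v) (lookup∘update i b 1) ([]≔-idempotent b i) ⟩
      bit (not x) * 1ℚ * E ∎

  eval-flipMono : ∀ b v → eval (flipMono b) (T i v) ≡ evalMono b v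
  eval-flipMono b v = eval-flipMonoAt b v refl

  flipMonoAt-∣ₘ : ∀ b {k} → lookup b i ≡ k → All (_∣ₘ b) (List.map proj₂ (flipMonoAt b k))
  flipMonoAt-∣ₘ b {zero}  _       = ∣ₘ-refl b ∷ []
  flipMonoAt-∣ₘ b {suc _} bᵢ≡1+k =
    []≔-∣ₘ b i z≤n ∷ []≔-∣ₘ b i (subst (1 ≤_) (sym bᵢ≡1+k) (s≤s z≤n)) ∷ []

  coeff-flipMono≢0⇒∣ₘ : ∀ b {a} → coeff (flipMono b) a ≢ 0ℚ → a ∣ₘ b
  coeff-flipMono≢0⇒∣ₘ b c≢0 = All.lookup (flipMonoAt-∣ₘ b refl) (coeff≢0⇒∈ (flipMono b) c≢0)

  coeff-flipMonoAt-diag : ∀ b {k} → lookup b i ≡ k → k ≤ 1 → coeff (flipMonoAt b k) b ≢ 0ℚ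
  coeff-flipMonoAt-diag b {zero} _ _ = subst (_≢ 0ℚ) (sym (coeff-∷-≡ 1ℚ b [])) (λ ())
  coeff-flipMonoAt-diag b {suc zero} bᵢ≡1 _ = subst (_≢ 0ℚ) (sym coeff≡-1) (λ ())
    where
    b[i≔1]≡b : b [ i ]≔ 1 ≡ b
    b[i≔1]≡b = trans (cong (b [ i ]≔_) (sym bᵢ≡1)) ([]≔-lookup b i)
    b[i≔0]≢b : b [ i ]≔ 0 ≢ b
    b[i≔0]≢b eq with trans (sym (lookup∘update i b 0)) (trans (cong (λ c → lookup c i) eq) bᵢ≡1)
    ... | ()
    coeff≡-1 : coeff (flipMonoAt b 1) b ≡ - 1ℚ + 0ℚ
    coeff≡-1 = begin
      coeff ((1ℚ , b [ i ]≔ 0) ∷ (- 1ℚ , b [ i ]≔ 1) ∷ []) b  ≡⟨ coeff-∷-≢ 1ℚ _ b[i≔0]≢b ⟩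
      coeff ((- 1ℚ , b [ i ]≔ 1) ∷ []) b                     ≡⟨ cong (λ e → coeff ((- 1ℚ , e) ∷ []) b) b[i≔1]≡b ⟩
      coeff ((- 1ℚ , b) ∷ []) b                              ≡⟨ coeff-∷-≡ (- 1ℚ) b [] ⟩
      - 1ℚ + 0ℚ                                              ∎
  coeff-flipMonoAt-diag b {suc (suc _)} _ (s≤s ())

  coeff-flipMono-diag : ∀ b → lookup b i ≤ 1 → coeff (flipMono b) b ≢ 0ℚ
  coeff-flipMono-diag b = coeff-flipMonoAt-diag b refl

  flipPoly-∈I : ∀ f {V} → f ∈I[ V ] → flipPoly f ∈I[ TV i V ]
  flipPoly-∈I f f∈I w w∈TV with ∈-map⁻ (T i) w∈TV
  ... | v , v∈V , refl = begin
    eval (flipPoly f) (T i v)                     ≡⟨ eval-substMono flipMono f (T i v) ⟩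
    linExt (λ b → eval (flipMono b) (T i v)) f    ≡⟨ linExt-cong (λ b → eval-flipMono b v) f ⟩
    linExt (λ b → evalMono b v) f                 ≡⟨ eval≡linExt f v ⟨
    eval f v                                      ≡⟨ f∈I v v∈V ⟩
    0ℚ                                            ∎

  module _ (ord : TermOrder n) where
    open TermOrder ord

    -- A term x^b of f with b ≢ a only reaches x^a if a ∣ b, and then b ≼ l ≼ a ≼ b.
    coeff-flipPoly-above : ∀ f {l a} → LeadingMono ord f l → l ≼ a →
      coeff (flipPoly f) a ≡ coeff f a * coeff (flipMono a) a
    coeff-flipPoly-above f {l} {a} (_ , lead) l≼a =
      trans (coeff-substMono flipMono f a) (linExt-concentrated (λ b → coeff (flipMono b) a) f a vanish)
      where
      vanish : ∀ b → b ≢ a → coeff f b ≡ 0ℚ ⊎ coeff (flipMono b) a ≡ 0ℚ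
      vanish b b≢a with coeff f b ℚₚ.≟ 0ℚ | coeff (flipMono b) a ℚₚ.≟ 0ℚ
      ... | yes fb≡0 | _         = inj₁ fb≡0
      ... | no  _    | yes φba≡0 = inj₂ φba≡0
      ... | no  fb≢0 | no  φba≢0 =
        contradiction (antisym≼ (trans≼ (lead b fb≢0) l≼a) (∣ₘ⇒≼ ord (coeff-flipMono≢0⇒∣ₘ b φba≢0)))
          b≢a

    flipPoly-LeadingMono : ∀ f {l} → LeadingMono ord f l → lookup l i ≤ 1 → LeadingMono ord (flipPoly f) l
    flipPoly-LeadingMono f {l} lm@(fl≢0 , lead) lᵢ≤1 = gl≢0 , gLead
      where
      gl≢0 : coeff (flipPoly f) l ≢ 0ℚ
      gl≢0 gl≡0 = fl≢0 (p*q≡0∧q≢0⇒p≡0 _ _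
        (trans (sym (coeff-flipPoly-above f lm (refl≼ l))) gl≡0) (coeff-flipMono-diag l lᵢ≤1))
      gLead : ∀ a → coeff (flipPoly f) a ≢ 0ℚ → a ≼ l
      gLead a ga≢0 with total≼ a l
      ... | inj₁ a≼l = a≼l
      ... | inj₂ l≼a = lead a λ fa≡0 → ga≢0 (begin
        coeff (flipPoly f) a                ≡⟨ coeff-flipPoly-above f lm l≼a ⟩
        coeff f a * coeff (flipMono a) a    ≡⟨ p≡0∨q≡0⇒p*q≡0 (inj₁ fa≡0) ⟩
        0ℚ                                  ∎)

    ∈in-TV : ∀ {V} m → lookup m i ≤ 1 → m ∈in[ ord , V ] → m ∈in[ ord , TV i V ]
    ∈in-TV m mᵢ≤1 (f , l , f∈I , lm , l∣m) =
      flipPoly f , l , flipPoly-∈I f f∈I , flipPoly-LeadingMono f lm (ℕₚ.≤-trans (l∣m i) mᵢ≤1) , l∣m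

∈in-antitone : ∀ {n} (ord : TermOrder n) {V W} m → V ⊆ W → m ∈in[ ord , W ] → m ∈in[ ord , V ]
∈in-antitone ord m V⊆W (f , l , f∈I , lm , l∣m) = f , l , (λ v v∈V → f∈I v (V⊆W v∈V)) , lm , l∣m

T-involutive : ∀ {n} (i : Fin n) (v : Point n) → T i (T i v) ≡ v
T-involutive i v = trans (updateAt-updateAt i v) (updateAt-id-local i v (not-involutive _))

⊆-TV-TV : ∀ {n} (i : Fin n) (V : List (Point n)) → V ⊆ TV i (TV i V)
⊆-TV-TV i V {v} v∈V = subst (_∈ TV i (TV i V)) (T-involutive i v) (∈-map⁺ (T i) (∈-map⁺ (T i) v∈V))

sqfree-≤1 : ∀ {n} (τ : Vec Bool n) i → lookup (sqfree τ) i ≤ 1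
sqfree-≤1 τ i rewrite lookup-map i (λ b → if b then 1 else 0) τ with lookup τ i
... | true  = ℕₚ.≤-refl
... | false = z≤n

lemma2p7 : (n : ℕ) (V : List (Point n)) (ord : TermOrder n) (i : Fin n) →
    (τ : Vec Bool n) →
      (τ ∈S[ ord , V ] → τ ∈S[ ord , TV i V ]) × (τ ∈S[ ord , TV i V ] → τ ∈S[ ord , V ])
lemma2p7 n V ord i τ = (λ τ∈S → τ∈S ∘ fromTV) , (λ τ∈S[TV] → τ∈S[TV] ∘ toTV)
  where
  open Flip i
  toTV : ∀ {W} → sqfree τ ∈in[ ord , W ] → sqfree τ ∈in[ ord , TV i W ]
  toTV = ∈in-TV ord (sqfree τ) (sqfree-≤1 τ i)
  fromTV : sqfree τ ∈in[ ord , TV i V ] → sqfree τ ∈in[ ord , V ]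
  fromTV = ∈in-antitone ord (sqfree τ) (⊆-TV-TV i V) ∘ toTV
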